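{- Let $d\in\{ -1,-2,-3,-7,-11\}$, $K=\mathbb{Q}(\sqrt d)$, and $\mathcal{O}_K$ its ring of integers. Let $x,y,r,r',N,S\in\mathcal{O}_K$ with $x,y,r,r',N$ nonzero, $(Sx+r)(Sy+r')=N$, $|r|,|r'|<\frac{\sqrt{15}}{4}|S|$, $|S|^3>|N|$, and $\gcd(S,r)=1$. Define $a_0=S$, $a_1=r'r^{ -1}\bmod S$ (a representative with $|a_1|\le\frac{\sqrt{15}}{4}|S|$), $b_0=0$, $b_1=1$, and recursively, while $a_k\ne0$, $a_{k+1}=a_{k-1}-q_ka_k$, $b_{k+1}=b_{k-1}-q_kb_k$, where $q_k\in\mathcal{O}_K$ is chosen with $|a_{k+1}|\le\frac{\sqrt{15}}{4}|a_k|$. Then there exists $k$ with $|a_kx+b_ky|<530|S|$.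
   Context: $r^{ -1}$ is an inverse of $r$ modulo $S$; $|\cdot|$ is the complex absolute value. For all $a,b\in\mathcal{O}_K$ with $b\ne0$ there is $q\in\mathcal{O}_K$ with $|a-qb|\le\frac{\sqrt{15}}{4}|b|$. -}

module Defs where

open import Data.Integer using (ℤ; +_; -[1+_]; _+_; _*_; -_; _-_; _<_; _≤_)
open import Data.Nat using (ℕ; suc)
open import Data.Product using (Σ; ∃; _×_; _,_)
open import Relation.Binary.PropositionalEquality using (_≡_)

data D : Set where
  d-1 d-2 d-3 d-7 d-11 : D

-- Elements of O_K, K = ℚ(√d), written in the standard integral basis {1, θ}:
--   d = -1, -2 :  θ = √d            (θ² = d)
--   d = -3,-7,-11: θ = (1 + √d)/2    (θ² = θ + m, m = (d-1)/4)
record OK (d : D) : Set where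
  constructor _⊕_θ
  field
    re : ℤ
    im : ℤ
open OK public

dval : D → ℤ
dval d-1 = - (+ 1)
dval d-2 = - (+ 2)
dval d-3 = - (+ 3)
dval d-7 = - (+ 7)
dval d-11 = - (+ 11)

mval : D → ℤ
mval d-3 = - (+ 1)
mval d-7 = - (+ 2)
mval d-11 = - (+ 3)
mval _ = + 0

0O : ∀ {d} → OK d
0O = (+ 0) ⊕ (+ 0) θ

1O : ∀ {d} → OK d
1O = (+ 1) ⊕ (+ 0) θ

_+O_ : ∀ {d} → OK d → OK d → OK d
(a ⊕ b θ) +O (c ⊕ e θ) = (a + c) ⊕ (b + e) θ

_-O_ : ∀ {d} → OK d → OK d → OK d
(a ⊕ b θ) -O (c ⊕ e θ) = (a - c) ⊕ (b - e) θ

_*O_ : ∀ {d} → OK d → OK d → OK d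
_*O_ {d-1} (a ⊕ b θ) (c ⊕ e θ) = (a * c + dval d-1 * (b * e)) ⊕ (a * e + b * c) θ
_*O_ {d-2} (a ⊕ b θ) (c ⊕ e θ) = (a * c + dval d-2 * (b * e)) ⊕ (a * e + b * c) θ
_*O_ {d-3} (a ⊕ b θ) (c ⊕ e θ) = (a * c + mval d-3 * (b * e)) ⊕ (a * e + b * c + b * e) θ
_*O_ {d-7} (a ⊕ b θ) (c ⊕ e θ) = (a * c + mval d-7 * (b * e)) ⊕ (a * e + b * c + b * e) θ
_*O_ {d-11} (a ⊕ b θ) (c ⊕ e θ) = (a * c + mval d-11 * (b * e)) ⊕ (a * e + b * c + b * e) θ

infixl 6 _+O_ _-O_
infixl 7 _*O_

abs² : ∀ {d} → OK d → ℤ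
abs² {d-1} (a ⊕ b θ) = a * a - dval d-1 * (b * b)
abs² {d-2} (a ⊕ b θ) = a * a - dval d-2 * (b * b)
abs² {d-3} (a ⊕ b θ) = a * a + a * b - mval d-3 * (b * b)
abs² {d-7} (a ⊕ b θ) = a * a + a * b - mval d-7 * (b * b)
abs² {d-11} (a ⊕ b θ) = a * a + a * b - mval d-11 * (b * b)

_∣O_ : ∀ {d} → OK d → OK d → Set
x ∣O y = ∃ λ c → y ≡ c *O x

Coprime : ∀ {d} → OK d → OK d → Set
Coprime {d} S r = ∀ (g : OK d) → g ∣O S → g ∣O r → g ∣O 1O

-- Comparisons of absolute values via squares:
--   |u| < (√15/4)|v|  ⟺  16|u|² < 15|v|²   (similarly for ≤)
--   |u| < c|v|        ⟺  |u|² < c²|v|²  (c ≥ 0)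
--   |u|³ > |v|        ⟺  (|u|²)³ > |v|²

-- Along the remainder sequence a_k b_{k+1} − a_{k+1} b_k = ±S; together with
-- |a_{k+1}| ≤ (√15/4)|a_k| this keeps |b_{k+1}| |a_k| ≤ 16 |S|, while |a_k| strictly decreases.
-- Since |r|, |r'| are small compared with |S|, (Sx + r)(Sy + r') = N and |N| < |S|³ give
-- |x| |y| ≤ 992 |S|.  At the first k with |a_k x|² < T |S|², T = 16 · 992, the previous index
-- bounds |b_k y|² ≤ T |S|² as well, so
-- |a_k x + b_k y|² ≤ 2|a_k x|² + 2|b_k y|² < 4T |S|² < 530² |S|².
module Submission where

open import Defs
open import Data.Integer using (ℤ; +_; _*_; _<_; _≤_)
open import Data.Nat using (ℕ; suc)
import Data.Nat as N
open import Data.Product using (∃; _×_)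
open import Relation.Binary.PropositionalEquality using (_≡_)
open import Relation.Nullary using (¬_)

open import Data.Integer
  using (0ℤ; 1ℤ; -[1+_]; _+_; _-_; -_; ∣_∣; +≤+; -≤+; +<+; positive; nonNegative; >-nonZero)
open import Data.Integer.Properties
open import Data.Integer.Tactic.RingSolver using (solve-∀; solve)
open import Data.List using (_∷_; [])
open import Data.Nat using (zero; z≤n; s≤s)
import Data.Nat.Properties as NP
open import Data.Product using (_,_; proj₁; proj₂; uncurry)
open import Data.Sum using (inj₁; inj₂)
open import Function using (_∘_)
open import Relation.Binary.PropositionalEquality
  using (refl; sym; trans; cong; cong₂; subst; subst₂; module ≡-Reasoning)
open import Relation.Nullary using (yes; no)
open import Relation.Unary using (Decidable)

0≤i*j : ∀ {i j} → 0ℤ ≤ i → 0ℤ ≤ j → 0ℤ ≤ i * j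
0≤i*j (+≤+ {n = m} _) (+≤+ {n = n} _) = subst (0ℤ ≤_) (pos-* m n) (+≤+ z≤n)

0≤i*i : ∀ i → 0ℤ ≤ i * i
0≤i*i (+ n)    = 0≤i*j {+ n} {+ n} (+≤+ z≤n) (+≤+ z≤n)
0≤i*i -[1+ n ] = +≤+ z≤n

0≤n*i⇒0≤i : ∀ n i → 0ℤ ≤ + suc n * i → 0ℤ ≤ i
0≤n*i⇒0≤i n (+ m) _ = +≤+ z≤n
0≤n*i⇒0≤i n -[1+ m ] ()

i+j≡0⇒i≡0 : ∀ {i j} → 0ℤ ≤ i → 0ℤ ≤ j → i + j ≡ 0ℤ → i ≡ 0ℤ
i+j≡0⇒i≡0 (+≤+ {n = m} _) (+≤+ {n = n} _) eq =
  cong +_ (NP.m+n≡0⇒m≡0 m (+-injective (trans (pos-+ m n) eq)))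

0<i⇒i*j≡0⇒j≡0 : ∀ {i j} → 0ℤ < i → i * j ≡ 0ℤ → j ≡ 0ℤ
0<i⇒i*j≡0⇒j≡0 {i} {j} 0<i eq = *-cancelˡ-≡ i j 0ℤ {{>-nonZero 0<i}} (trans eq (sym (*-zeroʳ i)))

i*i≡0⇒i≡0 : ∀ i → i * i ≡ 0ℤ → i ≡ 0ℤ
i*i≡0⇒i≡0 i eq with i*j≡0⇒i≡0∨j≡0 i eq
... | inj₁ i≡0 = i≡0
... | inj₂ i≡0 = i≡0

i*i≤j*j⇒i≤j : ∀ {i j} → 0ℤ ≤ j → i * i ≤ j * j → i ≤ j
i*i≤j*j⇒i≤j { -[1+ m ]} {+ n} _ _ = -≤+
i*i≤j*j⇒i≤j {+ m} {+ n} _ m²≤n² = +≤+ (NP.≮⇒≥ λ n<m →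
  <⇒≱ (subst₂ _<_ (pos-* n n) (pos-* m m) (+<+ (NP.*-mono-< n<m n<m))) m²≤n²)

∣i∣<∣j∣ : ∀ {i j} → 0ℤ ≤ i → i < j → ∣ i ∣ N.< ∣ j ∣
∣i∣<∣j∣ (+≤+ _) (+<+ m<n) = m<n

≤-by-difference : ∀ {i j} k → j - i ≡ k → 0ℤ ≤ k → i ≤ j
≤-by-difference k j-i≡k 0≤k = 0≤i-j⇒j≤i (subst (0ℤ ≤_) (sym j-i≡k) 0≤k)

≤-by-scaled-difference : ∀ {i j} n k → + suc n * (j - i) ≡ k → 0ℤ ≤ k → i ≤ j
≤-by-scaled-difference {i} {j} n k eq 0≤k =
  0≤i-j⇒j≤i (0≤n*i⇒0≤i n (j - i) (subst (0ℤ ≤_) (sym eq) 0≤k))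

*-mono-≤-nonNeg : ∀ {i j k l} → 0ℤ ≤ i → 0ℤ ≤ j → i ≤ k → j ≤ l → i * j ≤ k * l
*-mono-≤-nonNeg {i} {j} {k} {l} 0≤i 0≤j i≤k j≤l =
  ≤-trans (*-monoʳ-≤-nonNeg j {{nonNegative 0≤j}} i≤k)
          (*-monoˡ-≤-nonNeg k {{nonNegative (≤-trans 0≤i i≤k)}} j≤l)

0<i*j : ∀ {i j} → 0ℤ < i → 0ℤ < j → 0ℤ < i * j
0<i*j (+<+ {n = suc m} _) (+<+ {n = suc n} _) = +<+ (s≤s z≤n)

weighted-am-gm : ∀ u v {P Q C} → 0ℤ ≤ P → 0ℤ ≤ Q → C * C ≤ + 4 * P * Q →
                 u * v * C ≤ u * u * P + v * v * Q
weighted-am-gm u v {P} {Q} {C} 0≤P 0≤Q C²≤4PQ =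
  i*i≤j*j⇒i≤j {u * v * C} (+-mono-≤ (0≤i*j (0≤i*i u) 0≤P) (0≤i*j (0≤i*i v) 0≤Q))
    (≤-by-difference
      ((u * u * P - v * v * Q) * (u * u * P - v * v * Q) + u * u * (v * v) * (+ 4 * P * Q - C * C))
      (solve (u ∷ v ∷ P ∷ Q ∷ C ∷ []))
      (+-mono-≤ (0≤i*i (u * u * P - v * v * Q))
                (0≤i*j (0≤i*j (0≤i*i u) (0≤i*i v)) (i≤j⇒0≤j-i C²≤4PQ))))

weighted-triangle : ∀ u v {X P Q} → 0ℤ ≤ P → 0ℤ ≤ Q → (X - P - Q) * (X - P - Q) ≤ + 4 * P * Q →
                    u * v * X ≤ u * (u + v) * P + v * (u + v) * Q
weighted-triangle u v {X} {P} {Q} 0≤P 0≤Q C²≤4PQ =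
  ≤-by-difference (u * u * P + v * v * Q - u * v * (X - P - Q))
    (solve (u ∷ v ∷ X ∷ P ∷ Q ∷ []))
    (i≤j⇒0≤j-i (weighted-am-gm u v 0≤P 0≤Q C²≤4PQ))

-- With |r| ≤ (√15/4)|p|:  |p + r| ≥ |p| − |r| ≥ (1 − √15/4)|p|, and 1/992 < (1 − √15/4)².
reverse-triangle : ∀ {X P R} → 0ℤ ≤ P → 0ℤ ≤ R → (X - P - R) * (X - P - R) ≤ + 4 * P * R →
                   + 16 * R ≤ + 15 * P → P ≤ + 992 * X
reverse-triangle {X} {P} {R} 0≤P 0≤R C²≤4PR 16R≤15P =
  ≤-by-difference (+ 961 * P + + 1024 * R - + 992 * (P + R - X) + + 2 * (+ 15 * P - + 16 * R))
    (solve (X ∷ P ∷ R ∷ []))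
    (+-mono-≤ (i≤j⇒0≤j-i (weighted-am-gm (+ 31) (+ 32) 0≤P 0≤R C'²≤4PR))
              (0≤i*j (nonNegative⁻¹ (+ 2)) (i≤j⇒0≤j-i 16R≤15P)))
  where
  open ≤-Reasoning
  C'²≤4PR : (P + R - X) * (P + R - X) ≤ + 4 * P * R
  C'²≤4PR = begin
    (P + R - X) * (P + R - X) ≡⟨ solve (X ∷ P ∷ R ∷ []) ⟩
    (X - P - R) * (X - P - R) ≤⟨ C²≤4PR ⟩
    + 4 * P * R               ∎

-- The two norm forms: superscript ᴰ for θ² = D (norm a² − D b²) and
-- superscript ᴹ for θ² = θ + M (norm a² + ab − M b²).

normᴰ-* : ∀ D a b c e →
  (a * c + D * (b * e)) * (a * c + D * (b * e)) - D * ((a * e + b * c) * (a * e + b * c))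
  ≡ (a * a - D * (b * b)) * (c * c - D * (e * e))
normᴰ-* = solve-∀

normᴹ-* : ∀ M a b c e →
  (a * c + M * (b * e)) * (a * c + M * (b * e)) + (a * c + M * (b * e)) * (a * e + b * c + b * e)
    - M * ((a * e + b * c + b * e) * (a * e + b * c + b * e))
  ≡ (a * a + a * b - M * (b * b)) * (c * c + c * e - M * (e * e))
normᴹ-* = solve-∀

sos≡0 : ∀ {k} u v → 0ℤ < k → u * u + k * (v * v) ≡ 0ℤ → u ≡ 0ℤ × v ≡ 0ℤ
sos≡0 {k} u v 0<k eq =
  i*i≡0⇒i≡0 u (i+j≡0⇒i≡0 0≤u² 0≤kv² eq) ,
  i*i≡0⇒i≡0 v (0<i⇒i*j≡0⇒j≡0 0<k
    (i+j≡0⇒i≡0 0≤kv² 0≤u² (trans (+-comm (k * (v * v)) (u * u)) eq)))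
  where
  0≤u² = 0≤i*i u
  0≤kv² = 0≤i*j (<⇒≤ 0<k) (0≤i*i v)

normᴰ-nonNeg : ∀ D a b → 0ℤ < - D → 0ℤ ≤ a * a - D * (b * b)
normᴰ-nonNeg D a b 0<-D = begin
  0ℤ                      ≤⟨ +-mono-≤ (0≤i*i a) (0≤i*j (<⇒≤ 0<-D) (0≤i*i b)) ⟩
  a * a + (- D) * (b * b) ≡⟨ solve (D ∷ a ∷ b ∷ []) ⟩
  a * a - D * (b * b)     ∎
  where open ≤-Reasoning

normᴹ-nonNeg : ∀ M a b → 0ℤ < - (+ 4) * M - + 1 → 0ℤ ≤ a * a + a * b - M * (b * b)
normᴹ-nonNeg M a b 0<-Δ = 0≤n*i⇒0≤i 3 _ (begin
  0ℤ
    ≤⟨ +-mono-≤ (0≤i*i (+ 2 * a + b)) (0≤i*j (<⇒≤ 0<-Δ) (0≤i*i b)) ⟩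
  (+ 2 * a + b) * (+ 2 * a + b) + (- (+ 4) * M - + 1) * (b * b)
    ≡⟨ solve (M ∷ a ∷ b ∷ []) ⟩
  + 4 * (a * a + a * b - M * (b * b)) ∎)
  where open ≤-Reasoning

normᴰ≡0⇒≡0O : ∀ {d} D a b → 0ℤ < - D → a * a - D * (b * b) ≡ 0ℤ → (a ⊕ b θ) ≡ 0O {d}
normᴰ≡0⇒≡0O D a b 0<-D eq =
  uncurry (cong₂ _⊕_θ) (sos≡0 a b 0<-D (begin
    a * a + (- D) * (b * b) ≡⟨ solve (D ∷ a ∷ b ∷ []) ⟩
    a * a - D * (b * b)     ≡⟨ eq ⟩
    0ℤ                      ∎))
  where open ≡-Reasoning

normᴹ≡0⇒≡0O : ∀ {d} M a b → 0ℤ < - (+ 4) * M - + 1 → a * a + a * b - M * (b * b) ≡ 0ℤ →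
              (a ⊕ b θ) ≡ 0O {d}
normᴹ≡0⇒≡0O M a b 0<-Δ eq = cong₂ _⊕_θ a≡0 b≡0
  where
  sos : (+ 2 * a + b) * (+ 2 * a + b) + (- (+ 4) * M - + 1) * (b * b) ≡ 0ℤ
  sos = begin
    (+ 2 * a + b) * (+ 2 * a + b) + (- (+ 4) * M - + 1) * (b * b) ≡⟨ solve (M ∷ a ∷ b ∷ []) ⟩
    + 4 * (a * a + a * b - M * (b * b))                           ≡⟨ cong (+ 4 *_) eq ⟩
    0ℤ                                                            ∎
    where open ≡-Reasoning
  2a+b≡0 : + 2 * a + b ≡ 0ℤ
  2a+b≡0 = proj₁ (sos≡0 (+ 2 * a + b) b 0<-Δ sos)
  b≡0 : b ≡ 0ℤ
  b≡0 = proj₂ (sos≡0 (+ 2 * a + b) b 0<-Δ sos)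
  a≡0 : a ≡ 0ℤ
  a≡0 = *-cancelˡ-≡ (+ 2) a 0ℤ (begin
    + 2 * a      ≡⟨ sym (+-identityʳ (+ 2 * a)) ⟩
    + 2 * a + 0ℤ ≡⟨ cong (_+_ (+ 2 * a)) (sym b≡0) ⟩
    + 2 * a + b  ≡⟨ 2a+b≡0 ⟩
    0ℤ           ∎)
    where open ≡-Reasoning

normᴰ-neg : ∀ D a b → (+ 0 - a) * (+ 0 - a) - D * ((+ 0 - b) * (+ 0 - b)) ≡ a * a - D * (b * b)
normᴰ-neg = solve-∀

normᴹ-neg : ∀ M a b →
  (+ 0 - a) * (+ 0 - a) + (+ 0 - a) * (+ 0 - b) - M * ((+ 0 - b) * (+ 0 - b))
  ≡ a * a + a * b - M * (b * b)
normᴹ-neg = solve-∀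

normᴰ-cross : ∀ D a b c e → 0ℤ < - D →
  let P = a * a - D * (b * b)
      Q = c * c - D * (e * e)
      C = (a + c) * (a + c) - D * ((b + e) * (b + e)) - P - Q
  in C * C ≤ + 4 * P * Q
normᴰ-cross D a b c e 0<-D =
  ≤-by-difference (+ 4 * (- D) * ((a * e - b * c) * (a * e - b * c)))
    (solve (D ∷ a ∷ b ∷ c ∷ e ∷ []))
    (0≤i*j (0≤i*j (nonNegative⁻¹ (+ 4)) (<⇒≤ 0<-D)) (0≤i*i (a * e - b * c)))

normᴹ-cross : ∀ M a b c e → 0ℤ < - (+ 4) * M - + 1 →
  let P = a * a + a * b - M * (b * b)
      Q = c * c + c * e - M * (e * e)
      C = (a + c) * (a + c) + (a + c) * (b + e) - M * ((b + e) * (b + e)) - P - Q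
  in C * C ≤ + 4 * P * Q
normᴹ-cross M a b c e 0<-Δ =
  ≤-by-difference ((- (+ 4) * M - + 1) * ((a * e - b * c) * (a * e - b * c)))
    (solve (M ∷ a ∷ b ∷ c ∷ e ∷ []))
    (0≤i*j (<⇒≤ 0<-Δ) (0≤i*i (a * e - b * c)))

det-stepᴰ-re : ∀ D a₀ a₀' a₁ a₁' b₀ b₀' b₁ b₁' q q' →
  a₁ * (b₀ - (q * b₁ + D * (q' * b₁'))) + D * (a₁' * (b₀' - (q * b₁' + q' * b₁)))
    - ((a₀ - (q * a₁ + D * (q' * a₁'))) * b₁ + D * ((a₀' - (q * a₁' + q' * a₁)) * b₁'))
  ≡ + 0 - (a₀ * b₁ + D * (a₀' * b₁') - (a₁ * b₀ + D * (a₁' * b₀')))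
det-stepᴰ-re = solve-∀

det-stepᴰ-im : ∀ D a₀ a₀' a₁ a₁' b₀ b₀' b₁ b₁' q q' →
  a₁ * (b₀' - (q * b₁' + q' * b₁)) + a₁' * (b₀ - (q * b₁ + D * (q' * b₁')))
    - ((a₀ - (q * a₁ + D * (q' * a₁'))) * b₁' + (a₀' - (q * a₁' + q' * a₁)) * b₁)
  ≡ + 0 - (a₀ * b₁' + a₀' * b₁ - (a₁ * b₀' + a₁' * b₀))
det-stepᴰ-im = solve-∀

det-stepᴹ-re : ∀ M a₀ a₀' a₁ a₁' b₀ b₀' b₁ b₁' q q' →
  a₁ * (b₀ - (q * b₁ + M * (q' * b₁'))) + M * (a₁' * (b₀' - (q * b₁' + q' * b₁ + q' * b₁')))
    - ((a₀ - (q * a₁ + M * (q' * a₁'))) * b₁ + M * ((a₀' - (q * a₁' + q' * a₁ + q' * a₁')) * b₁'))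
  ≡ + 0 - (a₀ * b₁ + M * (a₀' * b₁') - (a₁ * b₀ + M * (a₁' * b₀')))
det-stepᴹ-re = solve-∀

det-stepᴹ-im : ∀ M a₀ a₀' a₁ a₁' b₀ b₀' b₁ b₁' q q' →
  a₁ * (b₀' - (q * b₁' + q' * b₁ + q' * b₁')) + a₁' * (b₀ - (q * b₁ + M * (q' * b₁')))
    + a₁' * (b₀' - (q * b₁' + q' * b₁ + q' * b₁'))
    - ((a₀ - (q * a₁ + M * (q' * a₁'))) * b₁' + (a₀' - (q * a₁' + q' * a₁ + q' * a₁')) * b₁
       + (a₀' - (q * a₁' + q' * a₁ + q' * a₁')) * b₁')
  ≡ + 0 - (a₀ * b₁' + a₀' * b₁ + a₀' * b₁' - (a₁ * b₀' + a₁' * b₀ + a₁' * b₀'))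
det-stepᴹ-im = solve-∀

det-initial-re : ∀ D s s' t t' → s * + 1 + D * (s' * + 0) - (t * + 0 + D * (t' * + 0)) ≡ s
det-initial-re = solve-∀

det-initialᴰ-im : ∀ s s' t t' → s * + 0 + s' * + 1 - (t * + 0 + t' * + 0) ≡ s'
det-initialᴰ-im = solve-∀

det-initialᴹ-im : ∀ s s' t t' → s * + 0 + s' * + 1 + s' * + 0 - (t * + 0 + t' * + 0 + t' * + 0) ≡ s'
det-initialᴹ-im = solve-∀

abs²-* : ∀ {d} (z w : OK d) → abs² (z *O w) ≡ abs² z * abs² w
abs²-* {d-1}  (a ⊕ b θ) (c ⊕ e θ) = normᴰ-* (dval d-1) a b c e
abs²-* {d-2}  (a ⊕ b θ) (c ⊕ e θ) = normᴰ-* (dval d-2) a b c e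
abs²-* {d-3}  (a ⊕ b θ) (c ⊕ e θ) = normᴹ-* (mval d-3) a b c e
abs²-* {d-7}  (a ⊕ b θ) (c ⊕ e θ) = normᴹ-* (mval d-7) a b c e
abs²-* {d-11} (a ⊕ b θ) (c ⊕ e θ) = normᴹ-* (mval d-11) a b c e

abs²-nonNeg : ∀ {d} (z : OK d) → 0ℤ ≤ abs² z
abs²-nonNeg {d-1}  (a ⊕ b θ) = normᴰ-nonNeg (dval d-1) a b (+<+ (s≤s z≤n))
abs²-nonNeg {d-2}  (a ⊕ b θ) = normᴰ-nonNeg (dval d-2) a b (+<+ (s≤s z≤n))
abs²-nonNeg {d-3}  (a ⊕ b θ) = normᴹ-nonNeg (mval d-3) a b (+<+ (s≤s z≤n))
abs²-nonNeg {d-7}  (a ⊕ b θ) = normᴹ-nonNeg (mval d-7) a b (+<+ (s≤s z≤n))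
abs²-nonNeg {d-11} (a ⊕ b θ) = normᴹ-nonNeg (mval d-11) a b (+<+ (s≤s z≤n))

abs²≡0⇒≡0O : ∀ {d} (z : OK d) → abs² z ≡ 0ℤ → z ≡ 0O
abs²≡0⇒≡0O {d-1}  (a ⊕ b θ) = normᴰ≡0⇒≡0O (dval d-1) a b (+<+ (s≤s z≤n))
abs²≡0⇒≡0O {d-2}  (a ⊕ b θ) = normᴰ≡0⇒≡0O (dval d-2) a b (+<+ (s≤s z≤n))
abs²≡0⇒≡0O {d-3}  (a ⊕ b θ) = normᴹ≡0⇒≡0O (mval d-3) a b (+<+ (s≤s z≤n))
abs²≡0⇒≡0O {d-7}  (a ⊕ b θ) = normᴹ≡0⇒≡0O (mval d-7) a b (+<+ (s≤s z≤n))
abs²≡0⇒≡0O {d-11} (a ⊕ b θ) = normᴹ≡0⇒≡0O (mval d-11) a b (+<+ (s≤s z≤n))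

abs²-0O : ∀ {d} → abs² (0O {d}) ≡ 0ℤ
abs²-0O {d-1}  = refl
abs²-0O {d-2}  = refl
abs²-0O {d-3}  = refl
abs²-0O {d-7}  = refl
abs²-0O {d-11} = refl

abs²-1O : ∀ {d} → abs² (1O {d}) ≡ 1ℤ
abs²-1O {d-1}  = refl
abs²-1O {d-2}  = refl
abs²-1O {d-3}  = refl
abs²-1O {d-7}  = refl
abs²-1O {d-11} = refl

abs²-neg : ∀ {d} (z : OK d) → abs² (0O -O z) ≡ abs² z
abs²-neg {d-1}  (a ⊕ b θ) = normᴰ-neg (dval d-1) a b
abs²-neg {d-2}  (a ⊕ b θ) = normᴰ-neg (dval d-2) a b
abs²-neg {d-3}  (a ⊕ b θ) = normᴹ-neg (mval d-3) a b
abs²-neg {d-7}  (a ⊕ b θ) = normᴹ-neg (mval d-7) a b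
abs²-neg {d-11} (a ⊕ b θ) = normᴹ-neg (mval d-11) a b

abs²-cross : ∀ {d} (z w : OK d) →
  let C = abs² (z +O w) - abs² z - abs² w in C * C ≤ + 4 * abs² z * abs² w
abs²-cross {d-1}  (a ⊕ b θ) (c ⊕ e θ) = normᴰ-cross (dval d-1) a b c e (+<+ (s≤s z≤n))
abs²-cross {d-2}  (a ⊕ b θ) (c ⊕ e θ) = normᴰ-cross (dval d-2) a b c e (+<+ (s≤s z≤n))
abs²-cross {d-3}  (a ⊕ b θ) (c ⊕ e θ) = normᴹ-cross (mval d-3) a b c e (+<+ (s≤s z≤n))
abs²-cross {d-7}  (a ⊕ b θ) (c ⊕ e θ) = normᴹ-cross (mval d-7) a b c e (+<+ (s≤s z≤n))
abs²-cross {d-11} (a ⊕ b θ) (c ⊕ e θ) = normᴹ-cross (mval d-11) a b c e (+<+ (s≤s z≤n))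

det-step : ∀ {d} (a₀ a₁ b₀ b₁ q : OK d) →
  a₁ *O (b₀ -O q *O b₁) -O (a₀ -O q *O a₁) *O b₁ ≡ 0O -O (a₀ *O b₁ -O a₁ *O b₀)
det-step {d-1} (a₀ ⊕ a₀' θ) (a₁ ⊕ a₁' θ) (b₀ ⊕ b₀' θ) (b₁ ⊕ b₁' θ) (q ⊕ q' θ) = cong₂ _⊕_θ
  (det-stepᴰ-re (dval d-1) a₀ a₀' a₁ a₁' b₀ b₀' b₁ b₁' q q')
  (det-stepᴰ-im (dval d-1) a₀ a₀' a₁ a₁' b₀ b₀' b₁ b₁' q q')
det-step {d-2} (a₀ ⊕ a₀' θ) (a₁ ⊕ a₁' θ) (b₀ ⊕ b₀' θ) (b₁ ⊕ b₁' θ) (q ⊕ q' θ) = cong₂ _⊕_θ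
  (det-stepᴰ-re (dval d-2) a₀ a₀' a₁ a₁' b₀ b₀' b₁ b₁' q q')
  (det-stepᴰ-im (dval d-2) a₀ a₀' a₁ a₁' b₀ b₀' b₁ b₁' q q')
det-step {d-3} (a₀ ⊕ a₀' θ) (a₁ ⊕ a₁' θ) (b₀ ⊕ b₀' θ) (b₁ ⊕ b₁' θ) (q ⊕ q' θ) = cong₂ _⊕_θ
  (det-stepᴹ-re (mval d-3) a₀ a₀' a₁ a₁' b₀ b₀' b₁ b₁' q q')
  (det-stepᴹ-im (mval d-3) a₀ a₀' a₁ a₁' b₀ b₀' b₁ b₁' q q')
det-step {d-7} (a₀ ⊕ a₀' θ) (a₁ ⊕ a₁' θ) (b₀ ⊕ b₀' θ) (b₁ ⊕ b₁' θ) (q ⊕ q' θ) = cong₂ _⊕_θ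
  (det-stepᴹ-re (mval d-7) a₀ a₀' a₁ a₁' b₀ b₀' b₁ b₁' q q')
  (det-stepᴹ-im (mval d-7) a₀ a₀' a₁ a₁' b₀ b₀' b₁ b₁' q q')
det-step {d-11} (a₀ ⊕ a₀' θ) (a₁ ⊕ a₁' θ) (b₀ ⊕ b₀' θ) (b₁ ⊕ b₁' θ) (q ⊕ q' θ) = cong₂ _⊕_θ
  (det-stepᴹ-re (mval d-11) a₀ a₀' a₁ a₁' b₀ b₀' b₁ b₁' q q')
  (det-stepᴹ-im (mval d-11) a₀ a₀' a₁ a₁' b₀ b₀' b₁ b₁' q q')

det-initial : ∀ {d} (z w : OK d) → z *O 1O -O w *O 0O ≡ z
det-initial {d-1}  (s ⊕ s' θ) (t ⊕ t' θ) =
  cong₂ _⊕_θ (det-initial-re (dval d-1) s s' t t') (det-initialᴰ-im s s' t t')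
det-initial {d-2}  (s ⊕ s' θ) (t ⊕ t' θ) =
  cong₂ _⊕_θ (det-initial-re (dval d-2) s s' t t') (det-initialᴰ-im s s' t t')
det-initial {d-3}  (s ⊕ s' θ) (t ⊕ t' θ) =
  cong₂ _⊕_θ (det-initial-re (mval d-3) s s' t t') (det-initialᴹ-im s s' t t')
det-initial {d-7}  (s ⊕ s' θ) (t ⊕ t' θ) =
  cong₂ _⊕_θ (det-initial-re (mval d-7) s s' t t') (det-initialᴹ-im s s' t t')
det-initial {d-11} (s ⊕ s' θ) (t ⊕ t' θ) =
  cong₂ _⊕_θ (det-initial-re (mval d-11) s s' t t') (det-initialᴹ-im s s' t t')

-O-+O-cancel : ∀ {d} (z w : OK d) → (z -O w) +O w ≡ z
-O-+O-cancel (a ⊕ b θ) (c ⊕ e θ) = cong₂ _⊕_θ (i-j+j≡i a c) (i-j+j≡i b e)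
  where
  i-j+j≡i : ∀ i j → i - j + j ≡ i
  i-j+j≡i = solve-∀

abs²-pos : ∀ {d} {z : OK d} → ¬ z ≡ 0O → 0ℤ < abs² z
abs²-pos {z = z} z≢0 = ≤∧≢⇒< (abs²-nonNeg z) (z≢0 ∘ abs²≡0⇒≡0O z ∘ sym)

abs²-+-≤-weighted : ∀ {d} u v (z w : OK d) →
                    u * v * abs² (z +O w) ≤ u * (u + v) * abs² z + v * (u + v) * abs² w
abs²-+-≤-weighted u v z w = weighted-triangle u v (abs²-nonNeg z) (abs²-nonNeg w) (abs²-cross z w)

abs²-+-≤ : ∀ {d} (z w : OK d) → abs² (z +O w) ≤ + 2 * abs² z + + 2 * abs² w
abs²-+-≤ z w =
  ≤-trans (≤-reflexive (sym (*-identityˡ (abs² (z +O w))))) (abs²-+-≤-weighted 1ℤ 1ℤ z w)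

abs²-+-≥ : ∀ {d} (p r : OK d) → + 16 * abs² r ≤ + 15 * abs² p → abs² p ≤ + 992 * abs² (p +O r)
abs²-+-≥ p r = reverse-triangle (abs²-nonNeg p) (abs²-nonNeg r) (abs²-cross p r)

abs²-*-+-≥ : ∀ {d} (p z r : OK d) → ¬ z ≡ 0O → + 16 * abs² r < + 15 * abs² p →
             abs² p * abs² z ≤ + 992 * abs² (p *O z +O r)
abs²-*-+-≥ p z r z≢0 16r<15p = begin
  abs² p * abs² z ≡⟨ abs²-* p z ⟨
  abs² (p *O z)   ≤⟨ abs²-+-≥ (p *O z) r r-small ⟩
  + 992 * abs² (p *O z +O r) ∎
  where
  open ≤-Reasoning
  r-small : + 16 * abs² r ≤ + 15 * abs² (p *O z)
  r-small = begin
    + 16 * abs² r             ≤⟨ <⇒≤ 16r<15p ⟩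
    + 15 * abs² p             ≡⟨ cong (+ 15 *_) (*-identityʳ (abs² p)) ⟨
    + 15 * (abs² p * 1ℤ)      ≤⟨ *-monoˡ-≤-nonNeg (+ 15)
                                   (*-monoˡ-≤-nonNeg (abs² p) {{nonNegative (abs²-nonNeg p)}}
                                     (i<j⇒suc[i]≤j (abs²-pos z≢0))) ⟩
    + 15 * (abs² p * abs² z)  ≡⟨ cong (+ 15 *_) (abs²-* p z) ⟨
    + 15 * abs² (p *O z)      ∎

shrinks⇒< : ∀ {A₁ A₂} → 0ℤ < A₁ → + 16 * A₂ ≤ + 15 * A₁ → A₂ < A₁
shrinks⇒< {A₁} {A₂} 0<A₁ 16A₂≤15A₁ = *-cancelˡ-<-nonNeg (+ 16) (begin-strict
  + 16 * A₂      ≤⟨ 16A₂≤15A₁ ⟩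
  + 15 * A₁      ≡⟨ +-identityʳ (+ 15 * A₁) ⟨
  + 15 * A₁ + 0ℤ <⟨ +-monoʳ-< (+ 15 * A₁) 0<A₁ ⟩
  + 15 * A₁ + A₁ ≡⟨ solve (A₁ ∷ []) ⟩
  + 16 * A₁      ∎)
  where open ≤-Reasoning

-- 256 is the fixed point of γ ↦ (240 + 16 · (15/16)² · γ) / 15.
b-bound-step : ∀ {s A₀ A₁ A₂ B₁ B₂} → 0ℤ ≤ B₁ →
  + 15 * (A₁ * B₂) ≤ + 240 * s + + 16 * (A₂ * B₁) →
  + 16 * A₂ ≤ + 15 * A₁ → + 16 * A₁ ≤ + 15 * A₀ →
  B₁ * A₀ ≤ + 256 * s → B₂ * A₁ ≤ + 256 * s
b-bound-step {s} {A₀} {A₁} {A₂} {B₁} {B₂} 0≤B₁ h₁ h₂ h₃ h₄ =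
  ≤-by-scaled-difference 239
    (+ 16 * (+ 240 * s + + 16 * (A₂ * B₁) - + 15 * (A₁ * B₂))
      + + 16 * B₁ * (+ 15 * A₁ - + 16 * A₂) + + 15 * B₁ * (+ 15 * A₀ - + 16 * A₁)
      + + 225 * (+ 256 * s - B₁ * A₀))
    (solve (s ∷ A₀ ∷ A₁ ∷ A₂ ∷ B₁ ∷ B₂ ∷ []))
    (+-mono-≤ (+-mono-≤ (+-mono-≤
      (0≤i*j (nonNegative⁻¹ (+ 16)) (i≤j⇒0≤j-i h₁))
      (0≤i*j (0≤i*j (nonNegative⁻¹ (+ 16)) 0≤B₁) (i≤j⇒0≤j-i h₂)))
      (0≤i*j (0≤i*j (nonNegative⁻¹ (+ 15)) 0≤B₁) (i≤j⇒0≤j-i h₃)))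
      (0≤i*j (nonNegative⁻¹ (+ 225)) (i≤j⇒0≤j-i h₄)))

xy-bound : ∀ c {s X Y U V} → 0ℤ < s → 0ℤ ≤ X → 0ℤ ≤ Y →
           s * X ≤ c * U → s * Y ≤ c * V → U * V < s * s * s → X * Y ≤ c * c * s
xy-bound c {s} {X} {Y} {U} {V} 0<s 0≤X 0≤Y sX≤cU sY≤cV UV<s³ =
  *-cancelˡ-≤-pos (X * Y) (c * c * s) s {{positive 0<s}}
    (*-cancelˡ-≤-pos (s * (X * Y)) (s * (c * c * s)) s {{positive 0<s}} (begin
      s * (s * (X * Y))     ≡⟨ solve (s ∷ X ∷ Y ∷ []) ⟩
      (s * X) * (s * Y)     ≤⟨ *-mono-≤-nonNeg (0≤i*j 0≤s 0≤X) (0≤i*j 0≤s 0≤Y) sX≤cU sY≤cV ⟩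
      (c * U) * (c * V)     ≡⟨ solve (c ∷ U ∷ V ∷ []) ⟩
      c * c * (U * V)       ≤⟨ *-monoˡ-≤-nonNeg (c * c) {{nonNegative (0≤i*i c)}} (<⇒≤ UV<s³) ⟩
      c * c * (s * s * s)   ≡⟨ solve (c ∷ s ∷ []) ⟩
      s * (s * (c * c * s)) ∎))
  where
  open ≤-Reasoning
  0≤s = <⇒≤ 0<s

b-term-bound : ∀ c {s A B X Y} → 0ℤ < c → 0ℤ < s → 0ℤ ≤ A → 0ℤ ≤ B → 0ℤ ≤ X → 0ℤ ≤ Y →
               B * A ≤ + 256 * s → + 16 * c * s ≤ A * X → X * Y ≤ c * c * s →
               B * Y ≤ + 16 * c * s
b-term-bound c {s} {A} {B} {X} {Y} 0<c 0<s 0≤A 0≤B 0≤X 0≤Y BA≤256s 16cs≤AX XY≤c²s =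
  *-cancelˡ-≤-pos (B * Y) (+ 16 * c * s) (+ 16 * c * s) {{positive 0<16cs}} (begin
    + 16 * c * s * (B * Y)
      ≤⟨ *-monoʳ-≤-nonNeg (B * Y) {{nonNegative (0≤i*j 0≤B 0≤Y)}} 16cs≤AX ⟩
    A * X * (B * Y)
      ≡⟨ solve (A ∷ X ∷ B ∷ Y ∷ []) ⟩
    (B * A) * (X * Y)
      ≤⟨ *-mono-≤-nonNeg (0≤i*j 0≤B 0≤A) (0≤i*j 0≤X 0≤Y) BA≤256s XY≤c²s ⟩
    (+ 256 * s) * (c * c * s)
      ≡⟨ solve (c ∷ s ∷ []) ⟩
    + 16 * c * s * (+ 16 * c * s) ∎)
  where
  open ≤-Reasoning
  0<16cs = 0<i*j (0<i*j (positive⁻¹ (+ 16)) 0<c) 0<s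

combination-bound : ∀ {s W P Q} → 0ℤ ≤ s → W ≤ + 2 * P + + 2 * Q →
                    P < + 16 * + 992 * s → Q ≤ + 16 * + 992 * s → W < + (530 N.* 530) * s
combination-bound {s} {W} {P} {Q} 0≤s W≤2P+2Q P<Ts Q≤Ts = begin-strict
  W                                           ≤⟨ W≤2P+2Q ⟩
  + 2 * P + + 2 * Q                           <⟨ +-mono-<-≤ (*-monoˡ-<-pos (+ 2) P<Ts)
                                                            (*-monoˡ-≤-nonNeg (+ 2) Q≤Ts) ⟩
  + 2 * (+ 15872 * s) + + 2 * (+ 15872 * s)   ≡⟨ solve (s ∷ []) ⟩
  + 63488 * s                                 ≤⟨ *-monoʳ-≤-nonNeg s {{nonNegative 0≤s}}
                                                   (+≤+ (NP.m≤m+n 63488 217412)) ⟩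
  + 280900 * s                                ∎
  where open ≤-Reasoning

least-witness : {P : ℕ → Set} → Decidable P → (μ : ℕ → ℕ) →
                (∀ j → (∀ i → i N.≤ j → ¬ P i) → μ (suc j) N.< μ j) →
                ∃ λ k → (∀ j → j N.< k → ¬ P j) × P k
least-witness {P} P? μ decreasing = search (suc (μ 0)) 0 (NP.n<1+n (μ 0)) (λ _ ())
  where
  search : ∀ n j → μ j N.< n → (∀ i → i N.< j → ¬ P i) → ∃ λ k → (∀ i → i N.< k → ¬ P i) × P k
  search zero    j ()    _
  search (suc n) j μj<1+n earlier with P? j
  ... | yes Pj  = j , earlier , Pj
  ... | no  ¬Pj = search n (suc j) (NP.<-≤-trans (decreasing j failed) (NP.≤-pred μj<1+n))
                         (λ i → failed i ∘ NP.≤-pred)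
    where
    failed : ∀ i → i N.≤ j → ¬ P i
    failed i i≤j with NP.m≤n⇒m<n∨m≡n i≤j
    ... | inj₁ i<j  = earlier i i<j
    ... | inj₂ refl = ¬Pj

module RemainderSequence {d : D} (S : OK d) (a b q : ℕ → OK d)
  (a₀≡S : a 0 ≡ S) (b₀≡0 : b 0 ≡ 0O) (b₁≡1 : b 1 ≡ 1O)
  (a₁-small : + 16 * abs² (a 1) ≤ + 15 * abs² S)
  (step : ∀ k → ¬ a (suc k) ≡ 0O →
    (a (suc (suc k)) ≡ a k -O q (suc k) *O a (suc k))
    × (b (suc (suc k)) ≡ b k -O q (suc k) *O b (suc k))
    × (+ 16 * abs² (a (suc (suc k))) ≤ + 15 * abs² (a (suc k))))
  where

  det : ℕ → OK d
  det j = a j *O b (suc j) -O a (suc j) *O b j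

  record Invariant (j : ℕ) : Set where
    field
      abs²-det  : abs² (det j) ≡ abs² S
      a-shrinks : + 16 * abs² (a (suc j)) ≤ + 15 * abs² (a j)
      b-bound   : abs² (b (suc j)) * abs² (a j) ≤ + 256 * abs² S

  invariant-zero : Invariant 0
  invariant-zero = record
    { abs²-det  = cong abs² det₀≡S
    ; a-shrinks = subst (λ z → + 16 * abs² (a 1) ≤ + 15 * abs² z) (sym a₀≡S) a₁-small
    ; b-bound   = b₁a₀≤256s
    }
    where
    det₀≡S : det 0 ≡ S
    det₀≡S = begin
      a 0 *O b 1 -O a 1 *O b 0 ≡⟨ cong₂ (λ α β → α *O β -O a 1 *O b 0) a₀≡S b₁≡1 ⟩
      S *O 1O -O a 1 *O b 0    ≡⟨ cong (λ β → S *O 1O -O a 1 *O β) b₀≡0 ⟩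
      S *O 1O -O a 1 *O 0O     ≡⟨ det-initial S (a 1) ⟩
      S                        ∎
      where open ≡-Reasoning
    b₁a₀≤256s : abs² (b 1) * abs² (a 0) ≤ + 256 * abs² S
    b₁a₀≤256s = begin
      abs² (b 1) * abs² (a 0) ≡⟨ cong₂ (λ β α → abs² β * abs² α) b₁≡1 a₀≡S ⟩
      abs² (1O {d}) * abs² S  ≡⟨ cong (_* abs² S) (abs²-1O {d}) ⟩
      1ℤ * abs² S             ≤⟨ *-monoʳ-≤-nonNeg (abs² S) {{nonNegative (abs²-nonNeg S)}}
                                   {1ℤ} {+ 256} (+≤+ (s≤s z≤n)) ⟩
      + 256 * abs² S          ∎
      where open ≤-Reasoning

  invariant-suc : ∀ j → ¬ a (suc j) ≡ 0O → Invariant j → Invariant (suc j)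
  invariant-suc j a₁≢0 inv with step j a₁≢0
  ... | a₂≡ , b₂≡ , a₂-shrinks = record
    { abs²-det  = abs²-det′
    ; a-shrinks = a₂-shrinks
    ; b-bound   = b-bound-step (abs²-nonNeg b₁) crossed a₂-shrinks a-shrinks b-bound
    }
    where
    open Invariant inv
    a₁ = a (suc j)
    a₂ = a (suc (suc j))
    b₁ = b (suc j)
    b₂ = b (suc (suc j))
    det-suc : det (suc j) ≡ 0O -O det j
    det-suc = begin
      a₁ *O b₂ -O a₂ *O b₁
        ≡⟨ cong₂ (λ α β → a₁ *O β -O α *O b₁) a₂≡ b₂≡ ⟩
      a₁ *O (b j -O q (suc j) *O b₁) -O (a j -O q (suc j) *O a₁) *O b₁
        ≡⟨ det-step (a j) a₁ (b j) b₁ (q (suc j)) ⟩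
      0O -O det j ∎
      where open ≡-Reasoning
    abs²-det′ : abs² (det (suc j)) ≡ abs² S
    abs²-det′ = trans (cong abs² det-suc) (trans (abs²-neg (det j)) abs²-det)
    crossed : + 15 * (abs² a₁ * abs² b₂) ≤ + 240 * abs² S + + 16 * (abs² a₂ * abs² b₁)
    crossed = begin
      + 15 * (abs² a₁ * abs² b₂)
        ≡⟨ cong (+ 15 *_) (abs²-* a₁ b₂) ⟨
      + 15 * abs² (a₁ *O b₂)
        ≡⟨ cong (λ z → + 15 * abs² z) (-O-+O-cancel (a₁ *O b₂) (a₂ *O b₁)) ⟨
      + 15 * abs² (det (suc j) +O a₂ *O b₁)
        ≤⟨ abs²-+-≤-weighted (+ 15) (+ 1) (det (suc j)) (a₂ *O b₁) ⟩
      + 240 * abs² (det (suc j)) + + 16 * abs² (a₂ *O b₁)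
        ≡⟨ cong₂ (λ u v → + 240 * u + + 16 * v) abs²-det′ (abs²-* a₂ b₁) ⟩
      + 240 * abs² S + + 16 * (abs² a₂ * abs² b₁) ∎
      where open ≤-Reasoning

  invariant : ∀ j → (∀ i → i N.≤ j → ¬ a i ≡ 0O) → Invariant j
  invariant zero    _    = invariant-zero
  invariant (suc j) a≢0O = invariant-suc j (a≢0O (suc j) NP.≤-refl)
                             (invariant j (λ i → a≢0O i ∘ NP.m≤n⇒m≤1+n))

  module _ (x y : OK d) (0<s : 0ℤ < abs² S)
           (xy-small : abs² x * abs² y ≤ + 992 * + 992 * abs² S) where

    Small : ℕ → Set
    Small j = abs² (a j) * abs² x < + 16 * + 992 * abs² S

    small? : Decidable Small
    small? j = abs² (a j) * abs² x <? + 16 * + 992 * abs² S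

    large⇒≢0O : ∀ {j} → ¬ Small j → ¬ a j ≡ 0O
    large⇒≢0O {j} large aj≡0 = large (begin-strict
      abs² (a j) * abs² x      ≡⟨ cong (λ z → abs² z * abs² x) aj≡0 ⟩
      abs² (0O {d}) * abs² x   ≡⟨ cong (_* abs² x) (abs²-0O {d}) ⟩
      0ℤ                       <⟨ *-monoˡ-<-pos (+ 16 * + 992) 0<s ⟩
      + 16 * + 992 * abs² S    ∎)
      where open ≤-Reasoning

    abs²-a-decreasing : ∀ j → (∀ i → i N.≤ j → ¬ Small i) → ∣ abs² (a (suc j)) ∣ N.< ∣ abs² (a j) ∣
    abs²-a-decreasing j large = ∣i∣<∣j∣ (abs²-nonNeg (a (suc j)))
      (shrinks⇒< (abs²-pos (large⇒≢0O (large j NP.≤-refl)))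
                 (Invariant.a-shrinks (invariant j (λ i → large⇒≢0O ∘ large i))))

    b-small : ∀ k → (∀ j → j N.< k → ¬ Small j) → abs² (b k) * abs² y ≤ + 16 * + 992 * abs² S
    b-small zero _ = begin
      abs² (b 0) * abs² y     ≡⟨ cong (λ z → abs² z * abs² y) b₀≡0 ⟩
      abs² (0O {d}) * abs² y  ≡⟨ cong (_* abs² y) (abs²-0O {d}) ⟩
      0ℤ                      ≤⟨ <⇒≤ (*-monoˡ-<-pos (+ 16 * + 992) 0<s) ⟩
      + 16 * + 992 * abs² S   ∎
      where open ≤-Reasoning
    b-small (suc j) large =
      b-term-bound (+ 992) (positive⁻¹ (+ 992)) 0<s (abs²-nonNeg (a j)) (abs²-nonNeg (b (suc j)))
        (abs²-nonNeg x) (abs²-nonNeg y)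
        (Invariant.b-bound (invariant j (λ i → large⇒≢0O ∘ large i ∘ s≤s)))
        (≮⇒≥ (large j NP.≤-refl)) xy-small

    short-combination : ∃ λ k → (∀ j → j N.< k → ¬ a j ≡ 0O)
                                × abs² (a k *O x +O b k *O y) < + (530 N.* 530) * abs² S
    short-combination =
      let k , large , small = least-witness small? (λ j → ∣ abs² (a j) ∣) abs²-a-decreasing
      in k , (λ j → large⇒≢0O ∘ large j) ,
         combination-bound (<⇒≤ 0<s) (abs²-+-≤ (a k *O x) (b k *O y))
           (subst (_< _) (sym (abs²-* (a k) x)) small)
           (subst (_≤ _) (sym (abs²-* (b k) y)) (b-small k large))

lemma2p11 : (d : D) (x y r r' Nn S : OK d) →
    ¬ x ≡ 0O → ¬ y ≡ 0O → ¬ r ≡ 0O → ¬ r' ≡ 0O → ¬ Nn ≡ 0O →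
    (S *O x +O r) *O (S *O y +O r') ≡ Nn →
    (+ 16) * abs² r < (+ 15) * abs² S →
    (+ 16) * abs² r' < (+ 15) * abs² S →
    abs² Nn < abs² S * abs² S * abs² S →
    Coprime S r →
    (a b q : ℕ → OK d) →
    a 0 ≡ S →
    S ∣O (a 1 *O r -O r') →
    (+ 16) * abs² (a 1) ≤ (+ 15) * abs² S →
    b 0 ≡ 0O →
    b 1 ≡ 1O →
    (∀ k → ¬ a (suc k) ≡ 0O →
      (a (suc (suc k)) ≡ a k -O q (suc k) *O a (suc k))
      × (b (suc (suc k)) ≡ b k -O q (suc k) *O b (suc k))
      × ((+ 16) * abs² (a (suc (suc k))) ≤ (+ 15) * abs² (a (suc k)))) →
    ∃ λ k → (∀ j → j N.< k → ¬ a j ≡ 0O)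
      × abs² (a k *O x +O b k *O y) < (+ (530 N.* 530)) * abs² S
-- Only the size of a₁ matters, not the congruence defining it.
lemma2p11 d x y r r' Nn S x≢0 y≢0 _ _ _ uv≡N 16r<15S 16r'<15S N<S³ _
          a b q a₀≡S _ a₁-small b₀≡0 b₁≡1 step =
  RemainderSequence.short-combination S a b q a₀≡S b₀≡0 b₁≡1 a₁-small step x y 0<s
    (xy-bound (+ 992) 0<s (abs²-nonNeg x) (abs²-nonNeg y)
      (abs²-*-+-≥ S x r x≢0 16r<15S) (abs²-*-+-≥ S y r' y≢0 16r'<15S) uv<s³)
  where
  0<s : 0ℤ < abs² S
  0<s = *-cancelˡ-<-nonNeg (+ 15)
          (≤-<-trans (0≤i*j (nonNegative⁻¹ (+ 16)) (abs²-nonNeg r)) 16r<15S)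
  uv<s³ : abs² (S *O x +O r) * abs² (S *O y +O r') < abs² S * abs² S * abs² S
  uv<s³ = subst (_< abs² S * abs² S * abs² S)
            (trans (cong abs² (sym uv≡N)) (abs²-* (S *O x +O r) (S *O y +O r'))) N<S³
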